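{- The set $\{\langle e,x\rangle : \mathcal L_e = \{L^e_x\}\}$ is $\Pi^0_2$-complete.
   Context: $W_0,W_1,\ldots$ is an acceptable numbering of all r.e. subsets of $\mathbb N$, and $\langle\cdot,\cdot\rangle$ is a standard recursive pairing function. For all $e,j$, $L^e_j = \{x : \langle j,x\rangle \in W_e\}$ and $\mathcal L_e = \{L^e_j : j\in\mathbb N\}$ (a family of sets, so $\mathcal L_e=\{L^e_x\}$ means every column of $W_e$ equals $L^e_x$). $\Pi^0_n$-complete means definable by a $\Pi^0_n$ formula and every $\Pi^0_n$ set many-one reduces to it via a recursive function. -}

module Defs where

open import Data.Nat using (ℕ; zero; suc; _+_; _*_; _<_; _/_)
open import Data.Fin using (Fin)
open import Data.Vec using (Vec; []; _∷_; lookup)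
open import Data.Product using (Σ; ∃; _×_; _,_)
open import Relation.Binary.PropositionalEquality using (_≡_)
open import Function using (_⇔_)

data Code : ℕ → Set where
  zeroC : ∀ {n} → Code n
  succC : Code 1
  projC : ∀ {n} → Fin n → Code n
  compC : ∀ {m n} → Code m → Vec (Code n) m → Code n
  precC : ∀ {n} → Code n → Code (suc (suc n)) → Code (suc n)
  muC   : ∀ {n} → Code (suc n) → Code n

mutual
  data Eval : ∀ {n} → Code n → Vec ℕ n → ℕ → Set where
    evZero : ∀ {n} {xs : Vec ℕ n} → Eval zeroC xs 0
    evSucc : ∀ {x} → Eval succC (x ∷ []) (suc x)
    evProj : ∀ {n} {i : Fin n} {xs} → Eval (projC i) xs (lookup xs i)
    evComp : ∀ {m n} {f : Code m} {gs : Vec (Code n) m} {xs ys v} →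
             EvalAll gs xs ys → Eval f ys v → Eval (compC f gs) xs v
    evPrec0 : ∀ {n} {g : Code n} {h} {xs v} →
              Eval g xs v → Eval (precC g h) (0 ∷ xs) v
    evPrecS : ∀ {n} {g : Code n} {h} {k xs u v} →
              Eval (precC g h) (k ∷ xs) u → Eval h (k ∷ u ∷ xs) v →
              Eval (precC g h) (suc k ∷ xs) v
    evMu : ∀ {n} {f : Code (suc n)} {xs y} →
           Eval f (y ∷ xs) 0 →
           (∀ z → z < y → Σ ℕ λ w → Eval f (z ∷ xs) (suc w)) →
           Eval (muC f) xs y

  data EvalAll : ∀ {m n} → Vec (Code n) m → Vec ℕ n → Vec ℕ m → Set where
    []  : ∀ {n} {xs : Vec ℕ n} → EvalAll [] xs []
    _∷_ : ∀ {m n} {g : Code n} {gs : Vec (Code n) m} {xs y ys} →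
          Eval g xs y → EvalAll gs xs ys → EvalAll (g ∷ gs) xs (y ∷ ys)

_≤m_ : (B A : ℕ → Set) → Set
B ≤m A = Σ (Code 1) λ c → ∀ x → Σ ℕ λ y → Eval c (x ∷ []) y × (B x ⇔ A y)

-- A recursive (decidable) ternary relation: its characteristic function
-- (0 = true) is computed by a total code.
RecursiveRel₃ : (ℕ → ℕ → ℕ → Set) → Set
RecursiveRel₃ R = Σ (Code 3) λ c → ∀ x y z → Σ ℕ λ v →
  Eval c (x ∷ y ∷ z ∷ []) v × (R x y z ⇔ v ≡ 0)

Π⁰₂ : (ℕ → Set) → Set₁
Π⁰₂ A = Σ (ℕ → ℕ → ℕ → Set) λ R → RecursiveRel₃ R ×
          (∀ x → A x ⇔ (∀ y → Σ ℕ λ z → R x y z))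

Π⁰₂-complete : (ℕ → Set) → Set₁
Π⁰₂-complete A = Π⁰₂ A × (∀ (B : ℕ → Set) → Π⁰₂ B → B ≤m A)

RE₂ : (ℕ → ℕ → Set) → Set
RE₂ A = Σ (Code 2) λ c → ∀ i x → A i x ⇔ (Σ ℕ λ v → Eval c (i ∷ x ∷ []) v)

-- Numberings of r.e. sets: W e x  means  x ∈ W_e.
Acceptable : (ℕ → ℕ → Set) → Set₁
Acceptable W = RE₂ W ×
  (∀ (A : ℕ → ℕ → Set) → RE₂ A →
     Σ (Code 1) λ c → ∀ i → Σ ℕ λ fi → Eval c (i ∷ []) fi × (∀ x → W fi x ⇔ A i x))

⟨_,_⟩ : ℕ → ℕ → ℕ
⟨ x , y ⟩ = ((x + y) * suc (x + y)) / 2 + y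

L : (W : ℕ → ℕ → Set) → ℕ → ℕ → ℕ → Set
L W e j x = W e ⟨ j , x ⟩

-- 𝓛_e = { L^e_x } : every column of W_e equals L^e_x
SingletonFamily : (W : ℕ → ℕ → Set) → ℕ → ℕ → Set
SingletonFamily W e x = ∀ j y → L W e j y ⇔ L W e x y

TheSet : (W : ℕ → ℕ → Set) → ℕ → Set
TheSet W n = Σ ℕ λ e → Σ ℕ λ x → (⟨ e , x ⟩ ≡ n) × SingletonFamily W e x

module Submission where

-- Upper bound.  n = ⟨ e , x ⟩ lies in the set iff for all j and y,
-- ⟨ j , y ⟩ ∈ W_e ⇔ ⟨ x , y ⟩ ∈ W_e.  Both sides are Σ⁰₁, witnessed by a halting run of
-- the code enumerating W, and an equivalence of Σ⁰₁ statements is Π⁰₂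
-- (equivalence-Π₂): "whatever shows up by stage s on one side shows up by some stage z
-- on the other".  Stages are made recursive by clocked evaluation: every code is
-- compiled into a total code computing a fuel-bounded evaluator (clocked-computes),
-- which is sound and eventually complete (run-sound, run-complete).
--
-- Lower bound.  If B x ⇔ ∀ y ∃ z R x y z, the r.e. family A_x whose column 0 is full and
-- whose column y + 1 is full iff ∃ z R x y z has indices g x by acceptability, and
-- x ↦ ⟨ g x , 0 ⟩ reduces B to the set.

open import Defs
open import Data.Nat using (ℕ; zero; suc; _+_; _*_; _∸_; _<_; _≤_; _/_; pred; _⊔_; z≤n; s≤s)
open import Data.Nat.Properties
open import Data.Nat.DivMod using (m*n/n≡m)
open import Data.Nat.Tactic.RingSolver using (solve-∀)
open import Data.Fin using (Fin; zero; suc; _↑ʳ_)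
open import Data.Vec using (Vec; []; _∷_; lookup; tabulate; head; tail; drop)
open import Data.Vec.Properties using (tabulate∘lookup)
open import Data.Product using (Σ; _×_; _,_; proj₁; proj₂)
open import Data.Sum using (inj₁; inj₂)
open import Data.Empty using (⊥; ⊥-elim)
open import Data.Unit using (⊤; tt)
open import Relation.Binary.PropositionalEquality
open import Relation.Binary.Definitions using (tri<; tri≈; tri>)
open import Relation.Nullary using (contradiction)
open import Function using (_⇔_; mk⇔; Equivalence)

infix 4 _Computes_ _Computes*_

_Computes_ : ∀ {n} → Code n → (Vec ℕ n → ℕ) → Set
c Computes f = ∀ xs → Eval c xs (f xs)

_Computes*_ : ∀ {m n} → Vec (Code n) m → (Vec ℕ n → Vec ℕ m) → Set
gs Computes* F = ∀ xs → EvalAll gs xs (F xs)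

[]ᶜ : ∀ {n} → [] Computes* (λ (_ : Vec ℕ n) → [])
[]ᶜ _ = []

infixr 5 _∷ᶜ_
_∷ᶜ_ : ∀ {m n} {g : Code n} {gs : Vec (Code n) m} {G F} →
       g Computes G → gs Computes* F → (g ∷ gs) Computes* (λ xs → G xs ∷ F xs)
(g-ok ∷ᶜ gs-ok) xs = g-ok xs ∷ gs-ok xs

proj-computes : ∀ {n} (i : Fin n) → projC i Computes (λ xs → lookup xs i)
proj-computes i _ = evProj

comp-computes : ∀ {m n} {f : Code m} {gs : Vec (Code n) m} {F G} →
                f Computes F → gs Computes* G → compC f gs Computes (λ xs → F (G xs))
comp-computes f-ok gs-ok xs = evComp (gs-ok xs) (f-ok _)

on₁ : (ℕ → ℕ) → Vec ℕ 1 → ℕ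
on₁ f (x ∷ []) = f x

on₂ : (ℕ → ℕ → ℕ) → Vec ℕ 2 → ℕ
on₂ f (x ∷ y ∷ []) = f x y

on₃ : (ℕ → ℕ → ℕ → ℕ) → Vec ℕ 3 → ℕ
on₃ f (x ∷ y ∷ z ∷ []) = f x y z

p0 : ∀ {n} → Code (suc n)
p0 = projC zero
p1 : ∀ {n} → Code (suc (suc n))
p1 = projC (suc zero)
p2 : ∀ {n} → Code (suc (suc (suc n)))
p2 = projC (suc (suc zero))
p3 : ∀ {n} → Code (suc (suc (suc (suc n))))
p3 = projC (suc (suc (suc zero)))

skipC : ∀ k {n} → Vec (Code (k + n)) n
skipC k = tabulate (λ i → projC (k ↑ʳ i))

skip-computes : ∀ k {n} → skipC k {n} Computes* drop k
skip-computes k xs = subst (EvalAll (skipC k) xs) (tabulate-drop k xs) (projections (k ↑ʳ_) xs)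
  where
  projections : ∀ {m n} (ρ : Fin m → Fin n) xs →
                EvalAll (tabulate (λ i → projC (ρ i))) xs (tabulate (λ i → lookup xs (ρ i)))
  projections {zero} ρ xs = []
  projections {suc m} ρ xs = evProj ∷ projections (λ i → ρ (suc i)) xs

  tabulate-drop : ∀ k {n} (xs : Vec ℕ (k + n)) → tabulate (λ i → lookup xs (k ↑ʳ i)) ≡ drop k xs
  tabulate-drop zero xs = tabulate∘lookup xs
  tabulate-drop (suc k) (x ∷ xs) = tabulate-drop k xs

caseℕ : ℕ → ℕ → (ℕ → ℕ) → ℕ
caseℕ zero z f = z
caseℕ (suc k) z f = f k

caseC : ∀ {n} → Code n → Code (suc n) → Code (suc n)
caseC z f = precC z (compC f (p0 ∷ skipC 2))

case-computes : ∀ {n} {z : Code n} {f Z F} → z Computes Z → f Computes F →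
                caseC z f Computes (λ xs → caseℕ (head xs) (Z (tail xs)) (λ k → F (k ∷ tail xs)))
case-computes z-ok f-ok (zero ∷ xs) = evPrec0 (z-ok xs)
case-computes z-ok f-ok (suc k ∷ xs) =
  evPrecS (case-computes z-ok f-ok (k ∷ xs)) (comp-computes f-ok (proj-computes zero ∷ᶜ skip-computes 2) _)

-- andThen r f: continue with f v if r encodes a result v (r = suc v), fail (0) otherwise.

andThen : ℕ → (ℕ → ℕ) → ℕ
andThen r f = caseℕ r 0 f

andThenC : ∀ {n} → Code n → Code (suc n) → Code n
andThenC a f = compC (caseC zeroC f) (a ∷ skipC 0)

andThen-computes : ∀ {n} {a : Code n} {f A F} → a Computes A → f Computes F →
                   andThenC a f Computes (λ xs → andThen (A xs) (λ v → F (v ∷ xs)))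
andThen-computes a-ok f-ok =
  comp-computes (case-computes (λ _ → evZero) f-ok) (a-ok ∷ᶜ skip-computes 0)

comp₁ : ∀ {n} {f : Code 1} {g : Code n} {F G} →
        f Computes on₁ F → g Computes G → compC f (g ∷ []) Computes (λ xs → F (G xs))
comp₁ f-ok g-ok = comp-computes f-ok (g-ok ∷ᶜ []ᶜ)

comp₂ : ∀ {n} {f : Code 2} {g h : Code n} {F G H} →
        f Computes on₂ F → g Computes G → h Computes H →
        compC f (g ∷ h ∷ []) Computes (λ xs → F (G xs) (H xs))
comp₂ f-ok g-ok h-ok = comp-computes f-ok (g-ok ∷ᶜ h-ok ∷ᶜ []ᶜ)

constC : ∀ n → ℕ → Code n
constC n zero = zeroC
constC n (suc k) = compC succC (constC n k ∷ [])

const-computes : ∀ n k → constC n k Computes (λ _ → k)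
const-computes n zero xs = evZero
const-computes n (suc k) xs = evComp (const-computes n k xs ∷ []) evSucc

succ-computes : succC Computes on₁ suc
succ-computes (x ∷ []) = evSucc

addC : Code 2
addC = precC p0 (compC succC (p1 ∷ []))

add-computes : addC Computes on₂ _+_
add-computes (zero ∷ y ∷ []) = evPrec0 evProj
add-computes (suc x ∷ y ∷ []) = evPrecS (add-computes (x ∷ y ∷ [])) (evComp (evProj ∷ []) evSucc)

predC : Code 1
predC = caseC zeroC p0

pred-computes : predC Computes on₁ pred
pred-computes (zero ∷ []) = case-computes (λ _ → evZero) (proj-computes zero) _
pred-computes (suc x ∷ []) = case-computes (λ _ → evZero) (proj-computes zero) _

monusC : Code 2
monusC = compC (precC p0 (compC predC (p1 ∷ []))) (p1 ∷ p0 ∷ [])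

monus-computes : monusC Computes on₂ _∸_
monus-computes (x ∷ y ∷ []) = evComp (evProj ∷ evProj ∷ []) (count-down y)
  where
  count-down : ∀ y → Eval (precC p0 (compC predC (p1 ∷ []))) (y ∷ x ∷ []) (x ∸ y)
  count-down zero = evPrec0 evProj
  count-down (suc y) = evPrecS (count-down y)
    (subst (Eval _ _) (pred[m∸n]≡m∸[1+n] x y) (comp₁ pred-computes (proj-computes (suc zero)) _))

isZero : ℕ → ℕ
isZero zero = 1
isZero (suc _) = 0

isZeroC : Code 1
isZeroC = caseC (constC 0 1) zeroC

isZero-computes : isZeroC Computes on₁ isZero
isZero-computes (zero ∷ []) = case-computes (const-computes 0 1) (λ _ → evZero) _
isZero-computes (suc x ∷ []) = case-computes (const-computes 0 1) (λ _ → evZero) _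

-- Cantor pairing.  ⟨ a , b ⟩ is the b-th element of the (a+b)-th diagonal, which
-- starts at the triangular number  triangle (a + b).

triangle : ℕ → ℕ
triangle zero = 0
triangle (suc k) = suc k + triangle k

cantor : ℕ → ℕ → ℕ
cantor a b = triangle (a + b) + b

pair≡cantor : ∀ a b → ⟨ a , b ⟩ ≡ cantor a b
pair≡cantor a b = cong (_+ b) (begin
  ((a + b) * suc (a + b)) / 2   ≡⟨ cong (_/ 2) (sym (twice-triangle (a + b))) ⟩
  (triangle (a + b) * 2) / 2     ≡⟨ m*n/n≡m (triangle (a + b)) 2 ⟩
  triangle (a + b)               ∎)
  where
  open ≡-Reasoning
  twice-triangle : ∀ k → triangle k * 2 ≡ k * suc k
  twice-triangle zero = refl
  twice-triangle (suc k) = begin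
    (suc k + triangle k) * 2        ≡⟨ *-distribʳ-+ 2 (suc k) (triangle k) ⟩
    suc k * 2 + triangle k * 2      ≡⟨ cong (suc k * 2 +_) (twice-triangle k) ⟩
    suc k * 2 + k * suc k           ≡⟨ ring k ⟩
    suc k * suc (suc k)             ∎
    where
    ring : ∀ k → suc k * 2 + k * suc k ≡ suc k * suc (suc k)
    ring = solve-∀

-- Pairs on a later diagonal have larger codes, so cantor is injective.

triangle-mono : ∀ {k l} → k ≤ l → triangle k ≤ triangle l
triangle-mono {zero} _ = z≤n
triangle-mono {suc k} {suc l} (s≤s k≤l) = +-mono-≤ (s≤s k≤l) (triangle-mono k≤l)

later-diagonal : ∀ a b c d → a + b < c + d → cantor a b < cantor c d
later-diagonal a b c d lt = begin-strict
  triangle (a + b) + b             ≤⟨ +-monoʳ-≤ (triangle (a + b)) (m≤n+m b a) ⟩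
  triangle (a + b) + (a + b)       <⟨ n<1+n _ ⟩
  suc (triangle (a + b) + (a + b)) ≡⟨ cong suc (+-comm (triangle (a + b)) (a + b)) ⟩
  triangle (suc (a + b))           ≤⟨ triangle-mono lt ⟩
  triangle (c + d)                 ≤⟨ m≤m+n (triangle (c + d)) d ⟩
  cantor c d                       ∎
  where open ≤-Reasoning

cantor-injective : ∀ {a b c d} → cantor a b ≡ cantor c d → a ≡ c × b ≡ d
cantor-injective {a} {b} {c} {d} eq with <-cmp (a + b) (c + d)
... | tri< lt _ _ = contradiction eq (<⇒≢ (later-diagonal a b c d lt))
... | tri> _ _ gt = contradiction (sym eq) (<⇒≢ (later-diagonal c d a b gt))
... | tri≈ _ same _ = +-cancelʳ-≡ b a c (trans same (cong (c +_) (sym b≡d))) , b≡d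
  where
  b≡d : b ≡ d
  b≡d = +-cancelˡ-≡ (triangle (a + b)) b d (trans eq (cong (λ k → triangle k + d) (sym same)))

-- Unpairing.  diag n is the diagonal containing n: it moves on to the next diagonal
-- exactly when n + 1 is the next triangular number.  The position on the diagonal
-- then gives both components.

diag : ℕ → ℕ
diag zero = 0
diag (suc n) = diag n + isZero (triangle (suc (diag n)) ∸ suc n)

π₁ π₂ : ℕ → ℕ
π₁ n = triangle (suc (diag n)) ∸ suc n
π₂ n = n ∸ triangle (diag n)

distance-to-end : ∀ a b → triangle (suc (a + b)) ∸ suc (cantor a b) ≡ a
distance-to-end a b = begin
  (a + b) + triangle (a + b) ∸ (triangle (a + b) + b)  ≡⟨ cong (_∸ (triangle (a + b) + b)) (ring a b (triangle (a + b))) ⟩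
  a + (triangle (a + b) + b) ∸ (triangle (a + b) + b)  ≡⟨ m+n∸n≡m a (triangle (a + b) + b) ⟩
  a                                                     ∎
  where
  open ≡-Reasoning
  ring : ∀ a b t → (a + b) + t ≡ a + (t + b)
  ring = solve-∀

cantor-suc : ∀ a b → Σ ℕ λ a′ → Σ ℕ λ b′ →
             suc (cantor a b) ≡ cantor a′ b′ × (a + b) + isZero a ≡ a′ + b′
cantor-suc zero b = suc b , 0 ,
  trans (cong suc (+-comm (triangle b) b)) (sym (trans (+-identityʳ _) (cong triangle (+-identityʳ (suc b))))) ,
  trans (+-comm b 1) (sym (+-identityʳ (suc b)))
cantor-suc (suc a) b = a , suc b , trans (sym (+-suc _ b)) (cong (λ k → triangle k + suc b) (sym (+-suc a b)))
                       , trans (+-identityʳ _) (sym (+-suc a b))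

diag-decomposes : ∀ n → Σ ℕ λ a → Σ ℕ λ b → cantor a b ≡ n × diag n ≡ a + b
diag-decomposes zero = 0 , 0 , refl , refl
diag-decomposes (suc n) with diag-decomposes n
... | a , b , refl , diag≡ with cantor-suc a b
... | a′ , b′ , next , diagonal′ = a′ , b′ , sym next , (begin
  diag n + isZero (triangle (suc (diag n)) ∸ suc n)  ≡⟨ cong (λ d → d + isZero (triangle (suc d) ∸ suc n)) diag≡ ⟩
  (a + b) + isZero (triangle (suc (a + b)) ∸ suc n)  ≡⟨ cong (λ k → (a + b) + isZero k) (distance-to-end a b) ⟩
  (a + b) + isZero a                                 ≡⟨ diagonal′ ⟩
  a′ + b′                                            ∎)
  where open ≡-Reasoning

π-cantor : ∀ a b → π₁ (cantor a b) ≡ a × π₂ (cantor a b) ≡ b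
π-cantor a b with diag-decomposes (cantor a b)
... | a′ , b′ , eq , diag≡ with cantor-injective {a′} {b′} {a} {b} eq
... | refl , refl rewrite diag≡ = distance-to-end a b , m+n∸m≡n (triangle (a + b)) b

π₁-pair : ∀ a b → π₁ ⟨ a , b ⟩ ≡ a
π₁-pair a b = trans (cong π₁ (pair≡cantor a b)) (proj₁ (π-cantor a b))

π₂-pair : ∀ a b → π₂ ⟨ a , b ⟩ ≡ b
π₂-pair a b = trans (cong π₂ (pair≡cantor a b)) (proj₂ (π-cantor a b))

pair-π : ∀ n → ⟨ π₁ n , π₂ n ⟩ ≡ n
pair-π n with diag-decomposes n
... | a , b , refl , _ = trans (cong₂ ⟨_,_⟩ (proj₁ (π-cantor a b)) (proj₂ (π-cantor a b))) (pair≡cantor a b)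

triangleC : Code 1
triangleC = precC zeroC (compC addC (compC succC (p0 ∷ []) ∷ p1 ∷ []))

triangle-computes : triangleC Computes on₁ triangle
triangle-computes (zero ∷ []) = evPrec0 evZero
triangle-computes (suc k ∷ []) = evPrecS (triangle-computes (k ∷ []))
  (comp₂ add-computes (comp₁ succ-computes (proj-computes zero)) (proj-computes (suc zero)) _)

pairC : Code 2
pairC = compC addC (compC triangleC (addC ∷ []) ∷ p1 ∷ [])

pair-computes : pairC Computes on₂ ⟨_,_⟩
pair-computes (a ∷ b ∷ []) = subst (Eval pairC _) (sym (pair≡cantor a b))
  (comp₂ add-computes (comp₁ triangle-computes add-computes) (proj-computes (suc zero)) _)

diagC : Code 1
diagC = precC zeroC
  (compC addC (p1 ∷ compC isZeroC (compC monusC (compC triangleC (compC succC (p1 ∷ []) ∷ [])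
                                                 ∷ compC succC (p0 ∷ []) ∷ []) ∷ []) ∷ []))

diag-computes : diagC Computes on₁ diag
diag-computes (zero ∷ []) = evPrec0 evZero
diag-computes (suc n ∷ []) = evPrecS (diag-computes (n ∷ []))
  (comp₂ add-computes (proj-computes (suc zero))
    (comp₁ isZero-computes (comp₂ monus-computes (comp₁ triangle-computes (comp₁ succ-computes (proj-computes (suc zero))))
                                                  (comp₁ succ-computes (proj-computes zero)))) _)

fstC sndC : Code 1
fstC = compC monusC (compC triangleC (compC succC (diagC ∷ []) ∷ []) ∷ compC succC (p0 ∷ []) ∷ [])
sndC = compC monusC (p0 ∷ compC triangleC (diagC ∷ []) ∷ [])

fst-computes : fstC Computes on₁ π₁
fst-computes (n ∷ []) =
  comp₂ monus-computes (comp₁ triangle-computes (comp₁ succ-computes diag-computes))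
                       (comp₁ succ-computes (proj-computes zero)) _

snd-computes : sndC Computes on₁ π₂
snd-computes (n ∷ []) = comp₂ monus-computes (proj-computes zero) (comp₁ triangle-computes diag-computes) _

mutual
  eval-det : ∀ {n} {c : Code n} {xs v w} → Eval c xs v → Eval c xs w → v ≡ w
  eval-det evZero evZero = refl
  eval-det evSucc evSucc = refl
  eval-det evProj evProj = refl
  eval-det (evComp args e) (evComp args′ e′) with evalAll-det args args′
  ... | refl = eval-det e e′
  eval-det (evPrec0 e) (evPrec0 e′) = eval-det e e′
  eval-det (evPrecS r e) (evPrecS r′ e′) with eval-det r r′
  ... | refl = eval-det e e′
  eval-det (evMu {y = y} root below) (evMu {y = y′} root′ below′) with <-cmp y y′
  ... | tri≈ _ y≡y′ _ = y≡y′
  ... | tri< y<y′ _ _ = ⊥-elim (root-not-positive root (below′ y y<y′))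
  ... | tri> _ _ y′<y = ⊥-elim (root-not-positive root′ (below y′ y′<y))

  root-not-positive : ∀ {n} {c : Code n} {xs} → Eval c xs 0 → Σ ℕ (λ w → Eval c xs (suc w)) → ⊥
  root-not-positive e (w , e′) with eval-det e e′
  ... | ()

  evalAll-det : ∀ {m n} {gs : Vec (Code n) m} {xs ys ys′} → EvalAll gs xs ys → EvalAll gs xs ys′ → ys ≡ ys′
  evalAll-det [] [] = refl
  evalAll-det (e ∷ es) (e′ ∷ es′) = cong₂ _∷_ (eval-det e e′) (evalAll-det es es′)

computes-unique : ∀ {n} {c : Code n} {f xs v} → c Computes f → Eval c xs v → v ≡ f xs
computes-unique c-ok e = eval-det e (c-ok _)

-- Clocked evaluation.  run c s xs = suc v records that c halts on xs with output v
-- using fuel s, and run c s xs = 0 that it has not (yet) halted; the fuel bounds each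
-- μ-search to the candidates 0, …, s.  Results are encoded as for andThen, so a
-- composite computation proceeds only when its parts have produced results.

guard : ℕ → ℕ → ℕ
guard r x = andThen r (λ _ → x)

-- The state q is 0 while searching,
-- 1 once the search has failed, and suc (suc y) once the least root y was found;
-- b is the clocked value of the searched function at t.
searchStep : ℕ → ℕ → ℕ → ℕ
searchStep q b t = caseℕ q (caseℕ b 1 (λ v → caseℕ v (suc (suc t)) (λ _ → 0))) suc

mutual
  run : ∀ {n} → Code n → ℕ → Vec ℕ n → ℕ
  run zeroC s xs = 1
  run succC s (x ∷ []) = suc (suc x)
  run (projC i) s xs = suc (lookup xs i)
  run (compC f gs) s xs = guard (allHalted gs s xs) (run f s (outputs gs s xs))
  run (precC g h) s (k ∷ xs) = runRec g h s k xs
  run (muC f) s xs = pred (search f s xs (suc s))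

  allHalted : ∀ {m n} → Vec (Code n) m → ℕ → Vec ℕ n → ℕ
  allHalted [] s xs = 1
  allHalted (g ∷ gs) s xs = guard (run g s xs) (allHalted gs s xs)

  outputs : ∀ {m n} → Vec (Code n) m → ℕ → Vec ℕ n → Vec ℕ m
  outputs [] s xs = []
  outputs (g ∷ gs) s xs = pred (run g s xs) ∷ outputs gs s xs

  runRec : ∀ {n} → Code n → Code (suc (suc n)) → ℕ → ℕ → Vec ℕ n → ℕ
  runRec g h s zero xs = run g s xs
  runRec g h s (suc k) xs = andThen (runRec g h s k xs) (λ u → run h s (k ∷ u ∷ xs))

  -- the state of the μ-search after trying the candidates 0, …, t - 1
  search : ∀ {n} → Code (suc n) → ℕ → Vec ℕ n → ℕ → ℕ
  search f s xs zero = 0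
  search f s xs (suc t) = searchStep (search f s xs t) (run f s (t ∷ xs)) t


-- Codes for the ingredients of run; the fuel is always the first argument.

guardC : ∀ {n} → Code n → Code n → Code n
guardC a k = andThenC a (compC k (skipC 1))

guard-computes : ∀ {n} {a k : Code n} {A K} → a Computes A → k Computes K →
                 guardC a k Computes (λ xs → guard (A xs) (K xs))
guard-computes a-ok k-ok = andThen-computes a-ok (comp-computes k-ok (skip-computes 1))

searchStepC : Code 3
searchStepC = caseC (caseC (constC 1 1) (caseC (compC succC (compC succC (p0 ∷ []) ∷ [])) zeroC))
                    (compC succC (p0 ∷ []))

searchStep-computes : searchStepC Computes on₃ searchStep
searchStep-computes (q ∷ b ∷ t ∷ []) =
  case-computes (case-computes (const-computes 1 1)
                               (case-computes (comp₁ succ-computes (comp₁ succ-computes (proj-computes zero)))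
                                              (λ _ → evZero)))
                (comp₁ succ-computes (proj-computes zero)) _

-- clocked c computes run c, taking the fuel as its first argument; it uses no μ, so it
-- is total.  A composition guards the clocked outer code by allHaltedC; a recursion
-- first swaps the fuel behind the recursion argument; a μ-search runs searchC for
-- s + 1 steps.

mutual
  clocked : ∀ {n} → Code n → Code (suc n)
  clocked {n} zeroC = constC (suc n) 1
  clocked succC = compC succC (compC succC (p1 ∷ []) ∷ [])
  clocked (projC i) = compC succC (projC (suc i) ∷ [])
  clocked (compC f gs) = guardC (allHaltedC gs) (compC (clocked f) (p0 ∷ outputsC gs))
  clocked (precC g h) = compC (precC (clocked g) (recStepC h)) (p1 ∷ p0 ∷ skipC 2)
  clocked (muC f) = compC predC (compC (precC zeroC (searchC f)) (compC succC (p0 ∷ []) ∷ skipC 0) ∷ [])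

  allHaltedC : ∀ {m n} → Vec (Code n) m → Code (suc n)
  allHaltedC {n = n} [] = constC (suc n) 1
  allHaltedC (g ∷ gs) = guardC (clocked g) (allHaltedC gs)

  outputsC : ∀ {m n} → Vec (Code n) m → Vec (Code (suc n)) m
  outputsC [] = []
  outputsC (g ∷ gs) = compC predC (clocked g ∷ []) ∷ outputsC gs

  -- on (k ∷ r ∷ s ∷ xs), with r = runRec g h s k xs
  recStepC : ∀ {n} → Code (suc (suc n)) → Code (suc (suc (suc n)))
  recStepC h = andThenC p1 (compC (clocked h) (p3 ∷ p1 ∷ p0 ∷ skipC 4))

  -- on (t ∷ q ∷ s ∷ xs), with q = search f s xs t
  searchC : ∀ {n} → Code (suc n) → Code (suc (suc (suc n)))
  searchC f = compC searchStepC (p1 ∷ compC (clocked f) (p2 ∷ p0 ∷ skipC 3) ∷ p0 ∷ [])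

mutual
  clocked-computes : ∀ {n} (c : Code n) → clocked c Computes (λ sxs → run c (head sxs) (tail sxs))
  clocked-computes {n} zeroC = const-computes (suc n) 1
  clocked-computes succC (s ∷ x ∷ []) = evComp (evComp (evProj ∷ []) evSucc ∷ []) evSucc
  clocked-computes (projC i) (s ∷ xs) = evComp (evProj ∷ []) evSucc
  clocked-computes (compC f gs) (s ∷ xs) =
    guard-computes (allHalted-computes gs)
                   (comp-computes (clocked-computes f) (proj-computes zero ∷ᶜ outputs-computes gs)) (s ∷ xs)
  clocked-computes (precC g h) (s ∷ k ∷ xs) =
    evComp (evProj ∷ evProj ∷ skip-computes 2 (s ∷ k ∷ xs)) (runRec-eval g h s xs k)
  clocked-computes (muC f) (s ∷ xs) =
    evComp (evComp (evComp (evProj ∷ []) evSucc ∷ skip-computes 0 (s ∷ xs)) (search-eval f s xs (suc s)) ∷ [])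
           (pred-computes _)

  allHalted-computes : ∀ {m n} (gs : Vec (Code n) m) →
                       allHaltedC gs Computes (λ sxs → allHalted gs (head sxs) (tail sxs))
  allHalted-computes {n = n} [] (s ∷ xs) = const-computes (suc n) 1 (s ∷ xs)
  allHalted-computes (g ∷ gs) (s ∷ xs) = guard-computes (clocked-computes g) (allHalted-computes gs) (s ∷ xs)

  outputs-computes : ∀ {m n} (gs : Vec (Code n) m) →
                     outputsC gs Computes* (λ sxs → outputs gs (head sxs) (tail sxs))
  outputs-computes [] (s ∷ xs) = []
  outputs-computes (g ∷ gs) (s ∷ xs) = comp₁ pred-computes (clocked-computes g) (s ∷ xs) ∷ outputs-computes gs (s ∷ xs)

  runRec-eval : ∀ {n} (g : Code n) h s xs k → Eval (precC (clocked g) (recStepC h)) (k ∷ s ∷ xs) (runRec g h s k xs)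
  runRec-eval g h s xs zero = evPrec0 (clocked-computes g (s ∷ xs))
  runRec-eval g h s xs (suc k) = evPrecS (runRec-eval g h s xs k)
    (andThen-computes (proj-computes (suc zero))
                      (comp-computes (clocked-computes h)
                                     (proj-computes _ ∷ᶜ proj-computes _ ∷ᶜ proj-computes zero ∷ᶜ skip-computes 4)) _)

  search-eval : ∀ {n} (f : Code (suc n)) s xs t → Eval (precC zeroC (searchC f)) (t ∷ s ∷ xs) (search f s xs t)
  search-eval f s xs zero = evPrec0 evZero
  search-eval f s xs (suc t) = evPrecS (search-eval f s xs t)
    (comp-computes searchStep-computes
                   (proj-computes _
                    ∷ᶜ comp-computes (clocked-computes f) (proj-computes _ ∷ᶜ proj-computes zero ∷ᶜ skip-computes 3)
                    ∷ᶜ proj-computes zero ∷ᶜ []ᶜ) _)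

andThen-suc : ∀ r {f v} → andThen r f ≡ suc v → Σ ℕ λ u → r ≡ suc u × f u ≡ suc v
andThen-suc (suc u) result = u , refl , result

andThen-≡ : ∀ {r u w} {f : ℕ → ℕ} → r ≡ suc u → f u ≡ w → andThen r f ≡ w
andThen-≡ refl result = result

extend-below : ∀ {t} {P : ℕ → Set} → (∀ z → z < t → P z) → P t → ∀ z → z < suc t → P z
extend-below below top z z<1+t with m<1+n⇒m<n∨m≡n z<1+t
... | inj₁ z<t = below z z<t
... | inj₂ refl = top

module Search {n} (f : Code (suc n)) (s : ℕ) (xs : Vec ℕ n) where

  Positive : ℕ → Set
  Positive z = Σ ℕ λ w → run f s (z ∷ xs) ≡ suc (suc w)

  LeastRoot : ℕ → Set
  LeastRoot y = run f s (y ∷ xs) ≡ 1 × (∀ z → z < y → Positive z)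

  Invariant : ℕ → ℕ → Set
  Invariant t zero = ∀ z → z < t → Positive z
  Invariant t (suc zero) = ⊤
  Invariant t (suc (suc y)) = LeastRoot y

  invariant : ∀ t → Invariant t (search f s xs t)
  invariant zero = λ _ ()
  invariant (suc t) = step (search f s xs t) (invariant t)
    where
    step : ∀ q → Invariant t q → Invariant (suc t) (searchStep q (run f s (t ∷ xs)) t)
    step (suc zero) _ = tt
    step (suc (suc y)) root = root
    step zero below with run f s (t ∷ xs) in ran
    ... | zero = tt
    ... | suc zero = ran , below
    ... | suc (suc w) = extend-below below (w , ran)

  found : ∀ {t} q {v} → pred q ≡ suc v → Invariant t q → LeastRoot v
  found (suc (suc y)) refl root = root

  searching : ∀ y → (∀ z → z < y → Positive z) → ∀ t → t ≤ y → search f s xs t ≡ 0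
  searching y below zero _ = refl
  searching y below (suc t) t<y with below t t<y
  ... | w , positive = cong₂ (λ q b → searchStep q b t) (searching y below t (<⇒≤ t<y)) positive

  settled : ∀ t {q} → search f s xs t ≡ suc q → ∀ d → search f s xs (d + t) ≡ suc q
  settled t decided zero = decided
  settled t decided (suc d) = cong (λ r → searchStep r (run f s ((d + t) ∷ xs)) (d + t)) (settled t decided d)

  finds : ∀ {y} → LeastRoot y → y ≤ s → run (muC f) s xs ≡ suc y
  finds {y} (root , below) y≤s = cong pred (begin
    search f s xs (suc s)            ≡⟨ cong (search f s xs) (sym fuel≡) ⟩
    search f s xs ((s ∸ y) + suc y)  ≡⟨ settled (suc y) hit (s ∸ y) ⟩
    suc (suc y)                      ∎)
    where
    open ≡-Reasoning
    hit : search f s xs (suc y) ≡ suc (suc y)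
    hit = cong₂ (λ q b → searchStep q b y) (searching y below y ≤-refl) root
    fuel≡ : (s ∸ y) + suc y ≡ suc s
    fuel≡ = trans (+-suc (s ∸ y) y) (cong suc (m∸n+n≡m y≤s))

mutual
  run-sound : ∀ {n} (c : Code n) s xs {v} → run c s xs ≡ suc v → Eval c xs v
  run-sound zeroC s xs refl = evZero
  run-sound succC s (x ∷ []) refl = evSucc
  run-sound (projC i) s xs refl = evProj
  run-sound (compC f gs) s xs result with andThen-suc (allHalted gs s xs) result
  ... | _ , halted , result′ = evComp (allHalted-sound gs s xs halted) (run-sound f s _ result′)
  run-sound (precC g h) s (k ∷ xs) result = runRec-sound g h s k xs result
  run-sound (muC f) s xs result
    with Search.found f s xs (search f s xs (suc s)) result (Search.invariant f s xs (suc s))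
  ... | root , below = evMu (run-sound f s _ root) λ z z<y → positive-sound f s xs z (below z z<y)

  positive-sound : ∀ {n} (f : Code (suc n)) s xs z → Search.Positive f s xs z → Σ ℕ λ w → Eval f (z ∷ xs) (suc w)
  positive-sound f s xs z (w , positive) = w , run-sound f s (z ∷ xs) positive

  allHalted-sound : ∀ {m n} (gs : Vec (Code n) m) s xs {u} → allHalted gs s xs ≡ suc u → EvalAll gs xs (outputs gs s xs)
  allHalted-sound [] s xs halted = []
  allHalted-sound (g ∷ gs) s xs halted with run g s xs in ran
  allHalted-sound (g ∷ gs) s xs () | zero
  allHalted-sound (g ∷ gs) s xs halted | suc w = run-sound g s xs ran ∷ allHalted-sound gs s xs halted

  runRec-sound : ∀ {n} (g : Code n) h s k xs {v} → runRec g h s k xs ≡ suc v → Eval (precC g h) (k ∷ xs) v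
  runRec-sound g h s zero xs result = evPrec0 (run-sound g s xs result)
  runRec-sound g h s (suc k) xs result with andThen-suc (runRec g h s k xs) result
  ... | _ , previous , result′ = evPrecS (runRec-sound g h s k xs previous) (run-sound h s _ result′)

Eventually : (ℕ → Set) → Set
Eventually P = Σ ℕ λ s₀ → ∀ s → s₀ ≤ s → P s

eventually-map : ∀ {P Q : ℕ → Set} → (∀ {s} → P s → Q s) → Eventually P → Eventually Q
eventually-map f (s₀ , p) = s₀ , λ s s₀≤s → f (p s s₀≤s)

eventually-both : ∀ {P Q : ℕ → Set} → Eventually P → Eventually Q → Eventually (λ s → P s × Q s)
eventually-both (s₁ , p) (s₂ , q) = s₁ ⊔ s₂ , λ s le → p s (m⊔n≤o⇒m≤o s₁ s₂ le) , q s (m⊔n≤o⇒n≤o s₁ s₂ le)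

eventually-below : ∀ y {P : ℕ → ℕ → Set} → (∀ z → z < y → Eventually (P z)) →
                   Eventually (λ s → ∀ z → z < y → P z s)
eventually-below zero _ = 0 , λ _ _ _ ()
eventually-below (suc y) ev =
  eventually-map (λ (below , top) → extend-below below top)
    (eventually-both (eventually-below y (λ z z<y → ev z (m<n⇒m<1+n z<y))) (ev y ≤-refl))

mutual
  run-complete : ∀ {n} {c : Code n} {xs v} → Eval c xs v → Eventually (λ s → run c s xs ≡ suc v)
  run-complete evZero = 0 , λ _ _ → refl
  run-complete evSucc = 0 , λ _ _ → refl
  run-complete evProj = 0 , λ _ _ → refl
  run-complete (evComp {f = f} args e) =
    eventually-map (λ ((halted , outs) , result) → andThen-≡ halted (trans (cong (run f _) outs) result))
      (eventually-both (allHalted-complete args) (run-complete e))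
  run-complete (evPrec0 e) = run-complete e
  run-complete (evPrecS previous e) =
    eventually-map (λ (p , r) → andThen-≡ p r) (eventually-both (run-complete previous) (run-complete e))
  run-complete (evMu {f = f} {xs} {y} root below) =
    eventually-map (λ ((r , b) , y≤s) → Search.finds f _ xs (r , b) y≤s)
      (eventually-both
        (eventually-both (run-complete root) (eventually-below y λ z z<y → positive-complete (below z z<y)))
        (y , λ _ y≤s → y≤s))

  positive-complete : ∀ {n} {f : Code (suc n)} {z xs} → Σ ℕ (λ w → Eval f (z ∷ xs) (suc w)) →
                      Eventually (λ s → Search.Positive f s xs z)
  positive-complete (w , e) = eventually-map (λ r → w , r) (run-complete e)

  allHalted-complete : ∀ {m n} {gs : Vec (Code n) m} {xs ys} → EvalAll gs xs ys →
                       Eventually (λ s → allHalted gs s xs ≡ 1 × outputs gs s xs ≡ ys)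
  allHalted-complete [] = 0 , λ _ _ → refl , refl
  allHalted-complete (e ∷ es) =
    eventually-map (λ (r , (h , o)) → andThen-≡ r h , cong₂ _∷_ (cong pred r) o)
      (eventually-both (run-complete e) (allHalted-complete es))

HasResult : ℕ → Set
HasResult r = Σ ℕ λ v → r ≡ suc v

implies : ℕ → ℕ → ℕ
implies p q = caseℕ p 0 (λ _ → isZero q)

impliesC : Code 2
impliesC = caseC zeroC (compC isZeroC (p1 ∷ []))

implies-computes : impliesC Computes on₂ implies
implies-computes (p ∷ q ∷ []) = case-computes (λ _ → evZero) (comp₁ isZero-computes (proj-computes _)) _

implies-result : ∀ p q → implies p q ≡ 0 → HasResult p → HasResult q
implies-result (suc _) (suc w) _ _ = w , refl

Approximates : (ℕ → ℕ) → Set → Set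
Approximates p P = (∀ s → HasResult (p s) → P) × (P → Eventually (λ s → HasResult (p s)))

implication-eventually : ∀ {p q P Q} → Approximates p P → Approximates q Q →
                         (P → Q) → ∀ s → Eventually (λ z → implies (p s) (q z) ≡ 0)
implication-eventually {p} (p-sound , _) (_ , q-complete) P→Q s with p s in ps
... | zero = 0 , λ _ _ → refl
... | suc v = eventually-map (λ (_ , qz) → cong isZero qz) (q-complete (P→Q (p-sound s (v , ps))))

implication-from : ∀ {p q P Q} → Approximates p P → Approximates q Q →
                   (∀ s → Σ ℕ λ z → implies (p s) (q z) ≡ 0) → P → Q
implication-from {p} {q} (_ , p-complete) (q-sound , _) tests holds with p-complete holds
... | s , results with tests s
... | z , test = q-sound z (implies-result (p s) (q z) test (results s ≤-refl))

equivalence-Π₂ : ∀ {p q P Q} → Approximates p P → Approximates q Q →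
                 (P ⇔ Q) ⇔ (∀ s → Σ ℕ λ z → implies (p s) (q z) + implies (q s) (p z) ≡ 0)
equivalence-Π₂ {p} {q} {P} {Q} p≈P q≈Q = mk⇔ forward backward
  where
  forward : P ⇔ Q → ∀ s → Σ ℕ λ z → implies (p s) (q z) + implies (q s) (p z) ≡ 0
  forward P⇔Q s with eventually-both (implication-eventually p≈P q≈Q (Equivalence.to P⇔Q) s)
                                     (implication-eventually q≈Q p≈P (Equivalence.from P⇔Q) s)
  ... | z , tests = z , cong₂ _+_ (proj₁ (tests z ≤-refl)) (proj₂ (tests z ≤-refl))
  backward : (∀ s → Σ ℕ λ z → implies (p s) (q z) + implies (q s) (p z) ≡ 0) → P ⇔ Q
  backward tests = mk⇔
    (implication-from p≈P q≈Q λ s → proj₁ (tests s) , m+n≡0⇒m≡0 _ (proj₂ (tests s)))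
    (implication-from q≈Q p≈P λ s → proj₁ (tests s) , m+n≡0⇒n≡0 _ (proj₂ (tests s)))

decode-triple : (Φ : ℕ → ℕ → ℕ → Set) → (∀ y → Φ (π₁ y) (π₁ (π₂ y)) (π₂ (π₂ y))) → ∀ a b c → Φ a b c
decode-triple Φ H a b c =
  subst₂ (Φ a) (π₁-pair b c) (π₂-pair b c)
    (subst (λ r → Φ a (π₁ r) (π₂ r)) (π₂-pair a ⟨ b , c ⟩)
      (subst (λ i → Φ i (π₁ (π₂ ⟨ a , ⟨ b , c ⟩ ⟩)) (π₂ (π₂ ⟨ a , ⟨ b , c ⟩ ⟩))) (π₁-pair a ⟨ b , c ⟩)
        (H ⟨ a , ⟨ b , c ⟩ ⟩)))

TheSet-decode : ∀ W n → TheSet W n ⇔ SingletonFamily W (π₁ n) (π₂ n)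
TheSet-decode W n = mk⇔
  (λ { (e , x , refl , single) → subst₂ (SingletonFamily W) (sym (π₁-pair e x)) (sym (π₂-pair e x)) single })
  (λ single → π₁ n , π₂ n , pair-π n , single)

least-zero : ∀ (f : ℕ → ℕ) z → f z ≡ 0 → Σ ℕ λ y → f y ≡ 0 × (∀ z′ → z′ < y → HasResult (f z′))
least-zero f zero f0 = 0 , f0 , λ _ ()
least-zero f (suc z) fz with f 0 in f0
... | zero = 0 , f0 , λ _ ()
... | suc w with least-zero (λ k → f (suc k)) z fz
... | y , fy , below = suc y , fy , λ { zero _ → w , f0 ; (suc z′) (s≤s z′<y) → below z′ z′<y }

module Membership (W : ℕ → ℕ → Set) (c : Code 2)
                  (c-enumerates : ∀ e m → W e m ⇔ (Σ ℕ λ v → Eval c (e ∷ m ∷ []) v)) where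

  stage : ℕ → ℕ → ℕ → ℕ
  stage e m s = run c s (e ∷ m ∷ [])

  stage-approximates : ∀ e m → Approximates (stage e m) (W e m)
  stage-approximates e m =
    (λ s (v , result) → Equivalence.from (c-enumerates e m) (v , run-sound c s _ result)) ,
    (λ w → let (v , ev) = Equivalence.to (c-enumerates e m) w in eventually-map (λ r → v , r) (run-complete ev))

  columnTest : ℕ → ℕ → ℕ → ℕ → ℕ → ℕ → ℕ
  columnTest e x j y s z = implies (stage e ⟨ j , y ⟩ s) (stage e ⟨ x , y ⟩ z)
                         + implies (stage e ⟨ x , y ⟩ s) (stage e ⟨ j , y ⟩ z)

  columns-agree : ∀ e x j y → (L W e j y ⇔ L W e x y) ⇔ (∀ s → Σ ℕ λ z → columnTest e x j y s z ≡ 0)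
  columns-agree e x j y = equivalence-Π₂ (stage-approximates e ⟨ j , y ⟩) (stage-approximates e ⟨ x , y ⟩)

  -- the recursive relation: decode n = ⟨ e , x ⟩ and y = ⟨ j , ⟨ y′ , s ⟩ ⟩
  relation : ℕ → ℕ → ℕ → ℕ
  relation n y z = columnTest (π₁ n) (π₂ n) (π₁ y) (π₁ (π₂ y)) (π₂ (π₂ y)) z

  TheSet⇔Π₂ : ∀ n → TheSet W n ⇔ (∀ y → Σ ℕ λ z → relation n y z ≡ 0)
  TheSet⇔Π₂ n = mk⇔
    (λ t y → Equivalence.to (columns-agree e x (π₁ y) (π₁ (π₂ y)))
                            (Equivalence.to (TheSet-decode W n) t (π₁ y) (π₁ (π₂ y))) (π₂ (π₂ y)))
    (λ tests → Equivalence.from (TheSet-decode W n) λ j y →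
       Equivalence.from (columns-agree e x j y)
         (decode-triple (λ j y s → Σ ℕ λ z → columnTest e x j y s z ≡ 0) tests j y))
    where
    e x : ℕ
    e = π₁ n
    x = π₂ n

  stageC : Code 3 → Code 3 → Code 3
  stageC col fuel = compC (clocked c)
    (fuel ∷ compC fstC (p0 ∷ []) ∷ compC pairC (col ∷ compC fstC (compC sndC (p1 ∷ []) ∷ []) ∷ []) ∷ [])

  stage-computes : ∀ {col fuel Col Fuel} → col Computes Col → fuel Computes Fuel →
    stageC col fuel Computes (λ v → stage (π₁ (lookup v zero)) ⟨ Col v , π₁ (π₂ (lookup v (suc zero))) ⟩ (Fuel v))
  stage-computes col-ok fuel-ok = comp-computes (clocked-computes c)
    (fuel-ok ∷ᶜ comp₁ fst-computes (proj-computes zero)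
             ∷ᶜ comp₂ pair-computes col-ok (comp₁ fst-computes (comp₁ snd-computes (proj-computes _))) ∷ᶜ []ᶜ)

  relationC : Code 3
  relationC = compC addC (compC impliesC (stageC jC sC ∷ stageC xC p2 ∷ []) ∷
                          compC impliesC (stageC xC sC ∷ stageC jC p2 ∷ []) ∷ [])
    where
    jC xC sC : Code 3
    jC = compC fstC (p1 ∷ [])
    xC = compC sndC (p0 ∷ [])
    sC = compC sndC (compC sndC (p1 ∷ []) ∷ [])

  relation-computes : relationC Computes on₃ relation
  relation-computes (n ∷ y ∷ z ∷ []) =
    comp₂ add-computes (comp₂ implies-computes (stage-computes j-ok s-ok) (stage-computes x-ok (proj-computes _)))
                       (comp₂ implies-computes (stage-computes x-ok s-ok) (stage-computes j-ok (proj-computes _))) _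
    where
    j-ok : compC fstC (p1 ∷ []) Computes (λ v → π₁ (lookup v (suc zero)))
    j-ok = comp₁ fst-computes (proj-computes (suc zero))
    x-ok : compC sndC (p0 ∷ []) Computes (λ v → π₂ (lookup v zero))
    x-ok = comp₁ snd-computes (proj-computes zero)
    s-ok : compC sndC (compC sndC (p1 ∷ []) ∷ []) Computes (λ v → π₂ (π₂ (lookup v (suc zero))))
    s-ok = comp₁ snd-computes (comp₁ snd-computes (proj-computes (suc zero)))

  Π₂-membership : Π⁰₂ (TheSet W)
  Π₂-membership = (λ n y z → relation n y z ≡ 0) ,
                  (relationC , λ n y z → relation n y z , relation-computes _ , mk⇔ (λ r → r) (λ r → r)) ,
                  TheSet⇔Π₂

-- For B x ⇔ ∀ y ∃ z R x y z, build the r.e. sets A_x whose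
-- column 0 is full and whose column y + 1 is full iff ∃ z R x y z (and empty otherwise);
-- then 𝓛_{g x} = {L^{g x}_0} for W_{g x} = A_x exactly when B x.
module Hardness (W : ℕ → ℕ → Set)
  (universal : ∀ (A : ℕ → ℕ → Set) → RE₂ A →
     Σ (Code 1) λ g → ∀ i → Σ ℕ λ gi → Eval g (i ∷ []) gi × (∀ x → W gi x ⇔ A i x))
  (B : ℕ → Set) (R : ℕ → ℕ → ℕ → Set) (r : Code 3)
  (r-decides : ∀ x y z → Σ ℕ λ v → Eval r (x ∷ y ∷ z ∷ []) v × (R x y z ⇔ v ≡ 0))
  (B-Π₂ : ∀ x → B x ⇔ (∀ y → Σ ℕ λ z → R x y z)) where

  test : ℕ → ℕ → ℕ → ℕ
  test x y z = proj₁ (r-decides x y z)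

  test-computes : r Computes on₃ test
  test-computes (x ∷ y ∷ z ∷ []) = proj₁ (proj₂ (r-decides x y z))

  Full : ℕ → ℕ → Set
  Full x zero = ⊤
  Full x (suc y) = Σ ℕ (R x y)

  A : ℕ → ℕ → Set
  A x m = Full x (π₁ m)

  witness : ℕ → ℕ → ℕ → ℕ
  witness z x m = caseℕ (π₁ m) 0 (λ y → test x y z)

  witnessC : Code 3
  witnessC = compC (caseC zeroC (compC r (p2 ∷ p0 ∷ p1 ∷ []))) (compC fstC (p2 ∷ []) ∷ p0 ∷ p1 ∷ [])

  witness-computes : witnessC Computes on₃ witness
  witness-computes (z ∷ x ∷ m ∷ []) =
    comp-computes (case-computes (λ _ → evZero)
                                 (comp-computes test-computes
                                                (proj-computes _ ∷ᶜ proj-computes _ ∷ᶜ proj-computes _ ∷ᶜ []ᶜ)))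
                  (comp₁ fst-computes (proj-computes _) ∷ᶜ proj-computes _ ∷ᶜ proj-computes _ ∷ᶜ []ᶜ) _

  witness-full : ∀ x col z → caseℕ col 0 (λ y → test x y z) ≡ 0 → Full x col
  witness-full x zero z _ = tt
  witness-full x (suc y) z t = z , Equivalence.from (proj₂ (proj₂ (r-decides x y z))) t

  full-witness : ∀ x col → Full x col → Σ ℕ λ z → caseℕ col 0 (λ y → test x y z) ≡ 0
  full-witness x zero _ = 0 , refl
  full-witness x (suc y) (z , Rz) = z , Equivalence.to (proj₂ (proj₂ (r-decides x y z))) Rz

  A-enumerated : ∀ x m → A x m ⇔ (Σ ℕ λ v → Eval (muC witnessC) (x ∷ m ∷ []) v)
  A-enumerated x m = mk⇔ enumerate recognise
    where
    enumerate : A x m → Σ ℕ λ v → Eval (muC witnessC) (x ∷ m ∷ []) v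
    enumerate full with full-witness x (π₁ m) full
    ... | z , wz with least-zero (λ z → witness z x m) z wz
    ... | y , wy , below = y , evMu (subst (Eval witnessC _) wy (witness-computes _)) λ z z<y →
      proj₁ (below z z<y) , subst (Eval witnessC _) (proj₂ (below z z<y)) (witness-computes _)
    recognise : (Σ ℕ λ v → Eval (muC witnessC) (x ∷ m ∷ []) v) → A x m
    recognise (v , evMu root _) = witness-full x (π₁ m) v (sym (computes-unique witness-computes root))

  g : Code 1
  g = proj₁ (universal A (muC witnessC , A-enumerated))

  g-indexes : ∀ x → Σ ℕ λ gx → Eval g (x ∷ []) gx × (∀ m → W gx m ⇔ A x m)
  g-indexes = proj₂ (universal A (muC witnessC , A-enumerated))

  reduction : B ≤m TheSet W
  reduction = compC pairC (g ∷ zeroC ∷ []) , λ x →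
    let (gx , gx-eval , W⇔A) = g-indexes x in
    ⟨ gx , 0 ⟩ , evComp (gx-eval ∷ evZero ∷ []) (pair-computes _) , mk⇔ (single x gx W⇔A) (satisfied x gx W⇔A)
    where
    member : ∀ x gx → (∀ m → W gx m ⇔ A x m) → ∀ j y → Full x j → L W gx j y
    member x gx W⇔A j y full = Equivalence.from (W⇔A _) (subst (Full x) (sym (π₁-pair j y)) full)

    single : ∀ x gx → (∀ m → W gx m ⇔ A x m) → B x → TheSet W ⟨ gx , 0 ⟩
    single x gx W⇔A b = gx , 0 , refl , λ j y →
      mk⇔ (λ _ → member x gx W⇔A 0 y tt) (λ _ → member x gx W⇔A j y (all-full j))
      where
      all-full : ∀ j → Full x j
      all-full zero = tt
      all-full (suc j) = Equivalence.to (B-Π₂ x) b j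

    satisfied : ∀ x gx → (∀ m → W gx m ⇔ A x m) → TheSet W ⟨ gx , 0 ⟩ → B x
    satisfied x gx W⇔A t = Equivalence.from (B-Π₂ x) λ y →
      subst (Full x) (π₁-pair (suc y) 0)
        (Equivalence.to (W⇔A _) (Equivalence.from (single′ (suc y) 0) (member x gx W⇔A 0 0 tt)))
      where
      single′ : SingletonFamily W gx 0
      single′ = subst₂ (SingletonFamily W) (π₁-pair gx 0) (π₂-pair gx 0) (Equivalence.to (TheSet-decode W _) t)

proposition2 : (W : ℕ → ℕ → Set) → Acceptable W → Π⁰₂-complete (TheSet W)
proposition2 W ((c , c-enumerates) , universal) =
  Membership.Π₂-membership W c c-enumerates ,
  λ B (R , (r , r-decides) , B-Π₂) → Hardness.reduction W universal B R r r-decides B-Π₂
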